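{- Fix an integer $\ell\geqslant 14$ and let $c=6\ell-5$. There is a constant $K$ depending only on $\ell$ such that the following holds. Let $G$ be a $C_{2\ell}$-saturated graph. Call a vertex $v$ of $G$ admissible if every vertex of $G$ at distance at most $\ell-2$ from $v$ has degree less than $c$, and for admissible $v$ put $D(v)=\{x\in V(G)\mid d_G(v,x)\leqslant \ell-1\}$. Let $\mathcal{P}$ be a maximal family of pairwise vertex-disjoint paths of length $2\ell-4$ in $G$ all of whose vertices have degree $2$ in $G$, let $S_0$ be the set of middle vertices of the paths in $\mathcal{P}$, and let $S\supseteq S_0$ be a maximal set of admissible vertices such that $D(x)\cap D(y)=\varnothing$ for any two distinct $x,y\in S$. Let $M=\bigcup_{x\in S}D(x)$. Then $|M|\leqslant K$.
   Context: All graphs are finite, simple, undirected. $C_{2\ell}$ is the cycle on $2\ell$ vertices; $G$ is $C_{2\ell}$-saturated if it contains no subgraph isomorphic to $C_{2\ell}$ and adding any edge between two nonadjacent vertices creates one. $d_G(u,v)$ is the distance in $G$. (The middle vertices of the paths in $\mathcal{P}$ are admissible and have pairwise disjoint sets $D(\cdot)$, so such $S$ exists.) -}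

module Defs where

open import Data.Nat using (ℕ; zero; suc; _+_; _*_; _∸_; _≤_; _<_)
open import Data.Fin using (Fin; toℕ; _≟_)
open import Data.Bool using (Bool; true; false; if_then_else_; _∨_; _∧_)
open import Data.List using (List; length; map; allFin)
open import Data.Nat.ListAction using (sum)
open import Data.List.Relation.Unary.All using (All)
open import Data.List.Relation.Unary.AllPairs using (AllPairs)
open import Data.List.Relation.Unary.Unique.Propositional using (Unique)
open import Data.Product using (Σ; _×_; ∃)
open import Data.Sum using (_⊎_)
open import Relation.Nullary using (¬_)
open import Relation.Nullary.Decidable using (⌊_⌋)
open import Relation.Binary.PropositionalEquality using (_≡_; _≢_)
open import Function.Definitions using (Injective)

record Graph (n : ℕ) : Set where
  field
    adj    : Fin n → Fin n → Bool
    sym    : ∀ u v → adj u v ≡ adj v u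
    irrefl : ∀ v → adj v v ≡ false
open Graph public

Adjacency : ℕ → Set
Adjacency n = Fin n → Fin n → Bool

addEdge : ∀ {n} → Adjacency n → Fin n → Fin n → Adjacency n
addEdge a u v x y =
  a x y ∨ ((⌊ x ≟ u ⌋ ∧ ⌊ y ≟ v ⌋) ∨ (⌊ x ≟ v ⌋ ∧ ⌊ y ≟ u ⌋))

deg : ∀ {n} → Graph n → Fin n → ℕ
deg {n} G v = sum (map (λ u → if adj G v u then 1 else 0) (allFin n))

data Walk {n : ℕ} (G : Graph n) : Fin n → Fin n → ℕ → Set where
  here : ∀ {u} → Walk G u u 0
  step : ∀ {u w v k} → adj G u w ≡ true → Walk G w v k → Walk G u v (suc k)

dist≤ : ∀ {n} → Graph n → Fin n → Fin n → ℕ → Set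
dist≤ G u v k = ∃ λ j → j ≤ k × Walk G u v j

ContainsCycle : ∀ {n} → Adjacency n → ℕ → Set
ContainsCycle {n} a m =
  Σ (Fin m → Fin n) λ f → Injective _≡_ _≡_ f ×
    (∀ (i j : Fin m) →
       (toℕ j ≡ suc (toℕ i) ⊎ (toℕ i ≡ m ∸ 1 × toℕ j ≡ 0)) →
       a (f i) (f j) ≡ true)

Saturated : ∀ {n} → Graph n → ℕ → Set
Saturated {n} G m =
  ¬ ContainsCycle (adj G) m ×
  (∀ (u v : Fin n) → u ≢ v → adj G u v ≡ false → ContainsCycle (addEdge (adj G) u v) m)

-- a path with vertices p 0, ..., p (m-1) (length m - 1), all of degree 2 in G
Deg2Path : ∀ {n} → Graph n → (m : ℕ) → (Fin m → Fin n) → Set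
Deg2Path G m p =
  Injective _≡_ _≡_ p ×
  (∀ i j → toℕ j ≡ suc (toℕ i) → adj G (p i) (p j) ≡ true) ×
  (∀ i → deg G (p i) ≡ 2)

VDisjoint : ∀ {n m} → (Fin m → Fin n) → (Fin m → Fin n) → Set
VDisjoint p q = ∀ i j → p i ≢ q j

Admissible : ∀ {n} → Graph n → ℕ → Fin n → Set
Admissible G ℓ v = ∀ w → dist≤ G v w (ℓ ∸ 2) → deg G w < 6 * ℓ ∸ 5

InD : ∀ {n} → Graph n → ℕ → Fin n → Fin n → Set
InD G ℓ v x = dist≤ G v x (ℓ ∸ 1)

DisjointD : ∀ {n} → Graph n → ℕ → Fin n → Fin n → Set
DisjointD G ℓ x y = ∀ w → ¬ (InD G ℓ x w × InD G ℓ y w)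

AtMost : ∀ {n} → (Fin n → Set) → ℕ → Set
AtMost {n} M K = ∀ (xs : List (Fin n)) → Unique xs → All M xs → length xs ≤ K

{-# OPTIONS --safe #-}
module Submission where

-- Since G is C_{2ℓ}-saturated, two distinct vertices x, y are joined by a walk of length at most
-- 2ℓ - 1: either they are adjacent, or the cycle created by adding xy runs from y back to x
-- through G. Cutting that walk in the middle gives an edge between D(x) and D(y).
--
-- Around an admissible vertex all degrees are below c, so |D(x)| ≤ L = (c + 1)^(ℓ-1). Listing
-- every D(x) in a fixed order, the positions (i , j) of such an edge colour the pairs x < y of S
-- with at most L² colours. If S were large, an ordered Ramsey argument would give centres
-- z₀ < … < z_{2ℓ-1} all of whose pairs have the same colour (i , j). Then the i-th vertices of
-- D(z₀), …, D(z_{ℓ-1}) and the j-th vertices of D(z_ℓ), …, D(z_{2ℓ-1}) span a K_{ℓ,ℓ}, whose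
-- vertices are distinct because the D's are disjoint; but K_{ℓ,ℓ} contains a C_{2ℓ}. So |S| is
-- below a Ramsey number depending only on ℓ, and |M| ≤ |S| L.

open import Defs hiding (sym)
open import Data.Nat using (ℕ; zero; suc; _+_; _*_; _∸_; _^_; _≤_; _<_; z≤n; s≤s; z<s; _<?_; _≤?_;
                            NonZero; >-nonZero; >-nonZero⁻¹)
import Data.Nat as ℕ
open import Data.Nat.Properties hiding (_≟_)
open import Data.Nat.DivMod
open import Data.Nat.ListAction using (sum)
open import Data.Fin using (Fin; toℕ; _≟_)
import Data.Fin as Fin
open import Data.Fin.Properties using (toℕ-fromℕ<; toℕ-injective; toℕ<n; ¬∀⟶∃¬; injective⇒≤)
open import Data.Bool using (true; false; if_then_else_)
import Data.Bool as Bool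
open import Data.Bool.Properties using (¬-not)
open import Data.List using (List; []; _∷_; [_]; length; map; filter; concatMap; allFin; lookup;
                             deduplicate; upTo; cartesianProduct)
open import Data.List.Properties using (length-++; length-map)
open import Data.List.Membership.Propositional using (_∈_; lose; find)
open import Data.List.Membership.Propositional.Properties
  using (∈-concatMap⁺; ∈-concatMap⁻; ∈-filter⁺; ∈-filter⁻; ∈-allFin; ∈-lookup; ∈-deduplicate⁺;
         ∈-deduplicate⁻; ∈-cartesianProduct⁺; ∈-upTo⁺)
import Data.List.Membership.Setoid.Properties as SetoidMembership
open import Data.List.Relation.Binary.Subset.Propositional using (_⊆_)
open import Data.List.Relation.Unary.Any as Any using (here; there)
open import Data.List.Relation.Unary.All as All using (All; []; _∷_)
open import Data.List.Relation.Unary.All.Properties using (all-filter)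
import Data.List.Relation.Unary.All.Properties as All
open import Data.List.Relation.Unary.AllPairs as AllPairs using (AllPairs; []; _∷_)
import Data.List.Relation.Unary.AllPairs.Properties as AllPairs
open import Data.List.Relation.Unary.Unique.Propositional using (Unique)
open import Data.List.Relation.Unary.Unique.DecPropositional.Properties using (deduplicate-!)
open import Data.Product using (∃; ∃₂; _×_; _,_; proj₁; proj₂)
import Data.Product as Product
open import Data.Product.Properties using (≡-dec)
open import Data.Sum using (_⊎_; inj₁; inj₂; [_,_]′)
import Data.Sum as Sum
open import Data.Empty using (⊥-elim)
open import Function using (_∘_; id)
open import Function.Definitions using (Injective)
open import Level using (0ℓ)
open import Relation.Nullary using (¬_; Dec; yes; no; does; contradiction)
open import Relation.Unary using (Pred; Decidable)
open import Relation.Unary.Properties using (∁?)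
open import Relation.Binary using (Rel; DecidableEquality; tri<; tri≈; tri>)
open import Relation.Binary.PropositionalEquality
  using (_≡_; _≢_; refl; sym; trans; cong; subst; subst₂; setoid; module ≡-Reasoning)

module _ {A : Set} where

  nth : A → List A → ℕ → A
  nth d []       _       = d
  nth d (x ∷ xs) zero    = x
  nth d (x ∷ xs) (suc k) = nth d xs k

  nth-∈ : ∀ d xs k → nth d xs k ∈ xs ⊎ nth d xs k ≡ d
  nth-∈ d []       k       = inj₂ refl
  nth-∈ d (x ∷ xs) zero    = inj₁ (here refl)
  nth-∈ d (x ∷ xs) (suc k) = Sum.map₁ there (nth-∈ d xs k)

  ∈⇒nth : ∀ d {x xs} → x ∈ xs → ∃ λ k → k < length xs × nth d xs k ≡ x
  ∈⇒nth d (here refl)  = 0 , s≤s z≤n , refl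
  ∈⇒nth d (there x∈xs) with k , k< , xs[k]≡x ← ∈⇒nth d x∈xs = suc k , s≤s k< , xs[k]≡x

  nth-All : ∀ {P : A → Set} d {xs t} → All P xs → t < length xs → P (nth d xs t)
  nth-All d {t = zero}  (Px ∷ _)   _        = Px
  nth-All d {t = suc t} (_  ∷ Pxs) (s≤s t<) = nth-All d Pxs t<

  nth-AllPairs : ∀ {R : A → A → Set} d {xs s t} → AllPairs R xs → s < t → t < length xs →
                 R (nth d xs s) (nth d xs t)
  nth-AllPairs d {s = zero}  {suc t} (Rx ∷ _)  _         (s≤s t<) = nth-All d Rx t<
  nth-AllPairs d {s = suc s} {suc t} (_ ∷ Rxs) (s≤s s<t) (s≤s t<) = nth-AllPairs d Rxs s<t t<

  AllPairs-withAll : ∀ {P : A → Set} {R : A → A → Set} {xs} → All P xs → AllPairs R xs →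
                     AllPairs (λ a b → P a × P b × R a b) xs
  AllPairs-withAll []         []         = []
  AllPairs-withAll (Pa ∷ Pas) (Ras ∷ Rs) =
    All.zipWith (λ (Pb , Rab) → Pa , Pb , Rab) (Pas , Ras) ∷ AllPairs-withAll Pas Rs

  lookup-injective : ∀ {xs : List A} → Unique xs → ∀ i j → lookup xs i ≡ lookup xs j → i ≡ j
  lookup-injective (_ ∷ _)      Fin.zero    Fin.zero    _  = refl
  lookup-injective (x∉ ∷ _)     Fin.zero    (Fin.suc j) eq = contradiction eq (All.lookup x∉ (∈-lookup j))
  lookup-injective (x∉ ∷ _)     (Fin.suc i) Fin.zero    eq = contradiction (sym eq) (All.lookup x∉ (∈-lookup i))
  lookup-injective (_ ∷ unique) (Fin.suc i) (Fin.suc j) eq = cong Fin.suc (lookup-injective unique i j eq)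

  Unique-⊆⇒length-≤ : ∀ {xs ys : List A} → Unique xs → xs ⊆ ys → length xs ≤ length ys
  Unique-⊆⇒length-≤ unique xs⊆ys = injective⇒≤ λ {i} {j} eq → lookup-injective unique i j
    (SetoidMembership.index-injective (setoid A) (xs⊆ys (∈-lookup i)) (xs⊆ys (∈-lookup j)) eq)

  module _ {P : Pred A 0ℓ} (P? : Decidable P) where

    length-filter-∁ : ∀ xs → length (filter P? xs) + length (filter (∁? P?) xs) ≡ length xs
    length-filter-∁ []       = refl
    length-filter-∁ (x ∷ xs) with does (P? x)
    ... | true  = cong suc (length-filter-∁ xs)
    ... | false = trans (+-suc _ _) (cong suc (length-filter-∁ xs))

    length-filter-filter : ∀ {Q : Pred A 0ℓ} (Q? : Decidable Q) xs →
                           length (filter P? (filter Q? xs)) ≤ length (filter P? xs)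
    length-filter-filter Q? []       = z≤n
    length-filter-filter Q? (x ∷ xs) with does (Q? x)
    ... | true  with does (P? x)
    ...   | true  = s≤s (length-filter-filter Q? xs)
    ...   | false = length-filter-filter Q? xs
    length-filter-filter Q? (x ∷ xs) | false with does (P? x)
    ...   | true  = m≤n⇒m≤1+n (length-filter-filter Q? xs)
    ...   | false = length-filter-filter Q? xs

length-concatMap-≤ : ∀ {A B : Set} (f : A → List B) {c} {xs : List A} →
                     All (λ a → length (f a) ≤ c) xs → length (concatMap f xs) ≤ length xs * c
length-concatMap-≤ f []                         = z≤n
length-concatMap-≤ f {xs = a ∷ _} (fa≤c ∷ rest) =
  ≤-trans (≤-reflexive (length-++ (f a))) (+-mono-≤ fa≤c (length-concatMap-≤ f rest))

module _ {A C : Set} (_≟ᶜ_ : DecidableEquality C) where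

  pigeonhole : (f : A → C) (cs : List C) (r : ℕ) {xs : List A} → All (λ x → f x ∈ cs) xs →
               length cs * r < length xs →
               ∃ λ c → c ∈ cs × r < length (filter (λ x → f x ≟ᶜ c) xs)
  pigeonhole f []       r {_ ∷ _} (() ∷ _) _
  pigeonhole f (c ∷ cs) r {xs} xs∈ r+|cs|r<|xs| with r <? length (filter (λ x → f x ≟ᶜ c) xs)
  ... | yes r<count = c , here refl , r<count
  ... | no  r≮count =
    let c′ , c′∈cs , r<count′ = pigeonhole f cs r others∈cs |cs|r<|others|
    in  c′ , there c′∈cs ,
        <-≤-trans r<count′ (length-filter-filter (λ x → f x ≟ᶜ c′) (∁? (λ x → f x ≟ᶜ c)) xs)
    where
    others = filter (∁? (λ x → f x ≟ᶜ c)) xs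

    others∈cs : All (λ x → f x ∈ cs) others
    others∈cs = All.zipWith (λ (∈c∷cs , ≢c) → Any.tail ≢c ∈c∷cs)
                            (All.filter⁺ _ xs∈ , all-filter _ xs)

    |cs|r<|others| : length cs * r < length others
    |cs|r<|others| =
      +-cancelˡ-< r _ _ (<-≤-trans (subst (_ <_) (sym (length-filter-∁ _ xs)) r+|cs|r<|xs|)
                                   (+-monoˡ-≤ _ (≮⇒≥ r≮count)))

-- One step keeps a single element and needs more than C · N(T) of the others for the pigeonhole.
steppingBound : ℕ → ℕ → ℕ
steppingBound C zero    = 0
steppingBound C (suc T) = suc (suc (C * steppingBound C T))

ramseyBound : ℕ → ℕ → ℕ
ramseyBound C r = steppingBound C (suc (C * r))

module Ramsey {A C : Set} (_≟ᶜ_ : DecidableEquality C) (colour : A → A → C) (cs : List C)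
              {Q : Rel A 0ℓ} (colour∈cs : ∀ {a b} → Q a b → colour a b ∈ cs) where

  ColouredByFirst : List (A × C) → Set
  ColouredByFirst = AllPairs (λ (a , c) (b , _) → Q a b × colour a b ≡ c)

  stepping : ∀ T {xs} → AllPairs Q xs → steppingBound (length cs) T ≤ length xs →
             ∃ λ ps → ColouredByFirst ps × All (λ (a , c) → a ∈ xs × c ∈ cs) ps × T ≤ length ps
  stepping zero    _          _           = [] , [] , [] , z≤n
  stepping (suc T) {y ∷ xs} (Qy ∷ Qxs) (s≤s bound≤) =
    let c , c∈cs , many =
          pigeonhole _≟ᶜ_ (colour y) cs (steppingBound (length cs) T) (All.map colour∈cs Qy) bound≤
        ps , stepped , ps∈ , T≤ = stepping T (AllPairs.filter⁺ _ Qxs) (<⇒≤ many)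
        from-y = All.map (λ (a∈ , _) → let a∈xs , ya≡c = ∈-filter⁻ (λ z → colour y z ≟ᶜ c) a∈
                                       in  All.lookup Qy a∈xs , ya≡c) ps∈
        ps∈y∷xs = All.map (Product.map₁ (there ∘ proj₁ ∘ ∈-filter⁻ _)) ps∈
    in  (y , c) ∷ ps , from-y ∷ stepped , (here refl , c∈cs) ∷ ps∈y∷xs , s≤s T≤

  ramsey : ∀ r {xs} → AllPairs Q xs → ramseyBound (length cs) r ≤ length xs →
           ∃₂ λ c ys → AllPairs (λ a b → Q a b × colour a b ≡ c) ys × r < length ys
  ramsey r Qxs bound≤ =
    let ps , stepped , ps∈ , many = stepping _ Qxs bound≤
        c , _ , r<count          = pigeonhole _≟ᶜ_ proj₂ cs r (All.map proj₂ ps∈) many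
        mono                     = filter (λ p → proj₂ p ≟ᶜ c) ps
    in  c , map proj₁ mono ,
        AllPairs.map⁺ (AllPairs.map (λ (p≡c , _ , Qab , ab≡p) → Qab , trans ab≡p p≡c)
                                    (AllPairs-withAll (all-filter _ ps) (AllPairs.filter⁺ _ stepped))) ,
        subst (r <_) (sym (length-map proj₁ mono)) r<count

module ModularArithmetic (m : ℕ) .{{_ : NonZero m}} where

  [j+a]%m≡[j+a%m]%m : ∀ j a → (j + a) % m ≡ (j + a % m) % m
  [j+a]%m≡[j+a%m]%m j a = begin
    (j + a) % m                   ≡⟨ cong (λ t → (j + t) % m) (m≡m%n+[m/n]*n a m) ⟩
    (j + (a % m + a / m * m)) % m ≡⟨ cong (_% m) (+-assoc j (a % m) _) ⟨
    (j + a % m + a / m * m) % m   ≡⟨ [m+kn]%n≡m%n (j + a % m) (a / m) m ⟩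
    (j + a % m) % m               ∎
    where open ≡-Reasoning

  [1+k]%m : ∀ k → suc k % m ≡ suc (k % m) ⊎ (k % m ≡ m ∸ 1 × suc k % m ≡ 0)
  [1+k]%m k with m≤n⇒m<n∨m≡n (m%n<n k m)
  ... | inj₁ 1+r<m = inj₁ (trans ([j+a]%m≡[j+a%m]%m 1 k) (m<n⇒m%n≡m 1+r<m))
  ... | inj₂ 1+r≡m =
    inj₂ (cong (_∸ 1) 1+r≡m , trans ([j+a]%m≡[j+a%m]%m 1 k) (trans (cong (_% m) 1+r≡m) (n%n≡0 m)))

  %-cong-suc : ∀ {i j} → i % m ≡ j % m → suc i % m ≡ suc j % m
  %-cong-suc {i} {j} i≡j =
    trans ([j+a]%m≡[j+a%m]%m 1 i) (trans (cong (λ r → suc r % m) i≡j) (sym ([j+a]%m≡[j+a%m]%m 1 j)))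

  [j+a]%m≢a%m : ∀ j a → 0 < j → j < m → (j + a) % m ≢ a % m
  [j+a]%m≢a%m j a 0<j j<m j+a≡a = [j+r]%m≢r (trans (sym ([j+a]%m≡[j+a%m]%m j a)) j+a≡a)
    where
    r = a % m

    [j+r]%m≢r : (j + r) % m ≢ r
    [j+r]%m≢r with j + r <? m
    ... | yes j+r<m = λ e → <-irrefl (trans (sym e) (m<n⇒m%n≡m j+r<m)) (m<n+m r 0<j)
    ... | no  j+r≮m = λ e → <-irrefl (trans (sym [j+r]%m≡d) e) d<r
      where
      m≤j+r = ≮⇒≥ j+r≮m
      d = j + r ∸ m

      d<r : d < r
      d<r = subst (d <_) (m+n∸m≡n m r) (∸-monoˡ-< (+-monoˡ-< r j<m) m≤j+r)

      d<m : d < m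
      d<m = subst (d <_) (m+n∸m≡n m m)
                  (∸-monoˡ-< (<-≤-trans (+-monoʳ-< j (m%n<n a m)) (+-monoˡ-≤ m (<⇒≤ j<m))) m≤j+r)

      [j+r]%m≡d : (j + r) % m ≡ d
      [j+r]%m≡d = trans (sym (m≤n⇒[n∸m]%m≡n%m m≤j+r)) (m<n⇒m%n≡m d<m)

Adjacent : ∀ {n} → Graph n → Fin n → Fin n → Set
Adjacent G u v = adj G u v ≡ true

module _ {n : ℕ} (G : Graph n) where

  adj-sym : ∀ {u v} → Adjacent G u v → Adjacent G v u
  adj-sym {u} {v} uv = trans (Graph.sym G v u) uv

  walk-snoc : ∀ {u v w j} → Walk G u v j → Adjacent G v w → Walk G u w (suc j)
  walk-snoc here         vw = step vw here
  walk-snoc (step uu′ p) vw = step uu′ (walk-snoc p vw)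

  walk-reverse : ∀ {u v j} → Walk G u v j → Walk G v u j
  walk-reverse here        = here
  walk-reverse (step uw p) = walk-snoc (walk-reverse p) (adj-sym uw)

  walk-along : (h : ℕ → Fin n) → ∀ d → (∀ k → k < d → Adjacent G (h k) (h (suc k))) →
               Walk G (h 0) (h d) d
  walk-along h zero    _     = here
  walk-along h (suc d) edges =
    walk-snoc (walk-along h d (λ k k<d → edges k (m<n⇒m<1+n k<d))) (edges d ≤-refl)

  walk-split : ∀ s t {u v j} → Walk G u v (suc j) → j ≤ s + t →
               ∃₂ λ a b → dist≤ G u a s × Adjacent G a b × dist≤ G b v t
  walk-split zero    t (step ub p)            j≤t = _ , _ , (0 , z≤n , here) , ub , (_ , j≤t , p)
  walk-split (suc s) t (step uv here)         _   = _ , _ , (0 , z≤n , here) , uv , (0 , z≤n , here)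
  walk-split (suc s) t (step uw (step wx p)) (s≤s j≤s+t)
    with a , b , (i , i≤s , q) , ab , bv ← walk-split s t (step wx p) j≤s+t
    = a , b , (suc i , s≤s i≤s , step uw q) , ab , bv

  dist≤-sym : ∀ {u v k} → dist≤ G u v k → dist≤ G v u k
  dist≤-sym (j , j≤k , p) = j , j≤k , walk-reverse p

  dist≤-weaken : ∀ {u v k k′} → k ≤ k′ → dist≤ G u v k → dist≤ G u v k′
  dist≤-weaken k≤k′ (j , j≤k , p) = j , ≤-trans j≤k k≤k′ , p

  dist≤-split : ∀ s t {u v} → u ≢ v → dist≤ G u v (suc (s + t)) →
                ∃₂ λ a b → dist≤ G u a s × Adjacent G a b × dist≤ G b v t
  dist≤-split s t u≢v (zero  , _         , here) = contradiction refl u≢v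
  dist≤-split s t u≢v (suc j , s≤s j≤s+t , p)    = walk-split s t p j≤s+t

Next : ∀ {m} → Fin m → Fin m → Set
Next {m} i j = toℕ j ≡ suc (toℕ i) ⊎ (toℕ i ≡ m ∸ 1 × toℕ j ≡ 0)

added-edge : ∀ {n} (a : Adjacency n) {x y u v} → addEdge a x y u v ≡ true → a u v ≡ false →
             (u ≡ x × v ≡ y) ⊎ (u ≡ y × v ≡ x)
added-edge a {x} {y} {u} {v} uv ¬uv rewrite ¬uv with u ≟ x | v ≟ y | u ≟ y | v ≟ x
... | yes u≡x | yes v≡y | _       | _       = inj₁ (u≡x , v≡y)
... | _       | _       | yes u≡y | yes v≡x = inj₂ (u≡y , v≡x)
... | no _    | _       | no _    | _       = contradiction uv λ ()
... | no _    | _       | yes _   | no _    = contradiction uv λ ()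
... | yes _   | no _    | no _    | _       = contradiction uv λ ()
... | yes _   | no _    | yes _   | no _    = contradiction uv λ ()

module CycleThroughAddedEdge {n m : ℕ} .{{_ : NonZero m}} (G : Graph n) {x y : Fin n}
                             (f : Fin m → Fin n) (f-injective : Injective _≡_ _≡_ f)
                             (f-cycle : ∀ i j → Next i j → addEdge (adj G) x y (f i) (f j) ≡ true) where
  open ModularArithmetic m

  NewEdgesJoin : Fin n → Fin n → Set
  NewEdgesJoin u v = ∀ {a b} → addEdge (adj G) x y a b ≡ true → adj G a b ≡ false →
                     (a ≡ u × b ≡ v) ⊎ (a ≡ v × b ≡ u)

  1+[m∸1]≡m : suc (m ∸ 1) ≡ m
  1+[m∸1]≡m = m+[n∸m]≡n (>-nonZero⁻¹ m)

  h : ℕ → Fin n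
  h k = f (k mod m)

  h-≡ : ∀ {k} i → k % m ≡ toℕ i → h k ≡ f i
  h-≡ i k≡i = cong f (toℕ-injective (trans (toℕ-fromℕ< _) k≡i))

  h-periodic : ∀ {k k′} → k % m ≡ k′ % m → h k ≡ h k′
  h-periodic {k′ = k′} k≡k′ = h-≡ (k′ mod m) (trans k≡k′ (sym (toℕ-fromℕ< _)))

  h-position : ∀ {k k′} → h k ≡ h k′ → k % m ≡ k′ % m
  h-position hk≡hk′ =
    trans (sym (toℕ-fromℕ< _)) (trans (cong toℕ (f-injective hk≡hk′)) (toℕ-fromℕ< _))

  h-edge : ∀ k → addEdge (adj G) x y (h k) (h (suc k)) ≡ true
  h-edge k = f-cycle _ _
    (Sum.map (λ 1+k≡ → trans (toℕ-fromℕ< _) (trans 1+k≡ (cong suc (sym (toℕ-fromℕ< _)))))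
             (Product.map (trans (toℕ-fromℕ< _)) (trans (toℕ-fromℕ< _)))
             ([1+k]%m k))

  cycle-in-G : (∀ (i : Fin m) → Adjacent G (h (toℕ i)) (h (suc (toℕ i)))) → ContainsCycle (adj G) m
  cycle-in-G edges = f , f-injective , λ i j i→j →
    subst₂ (Adjacent G) (h-≡ i (m<n⇒m%n≡m (toℕ<n i))) (h-≡ j (successor i j i→j)) (edges i)
    where
    successor : ∀ i j → Next i j → suc (toℕ i) % m ≡ toℕ j
    successor i j (inj₁ j≡1+i)         = trans (cong (_% m) (sym j≡1+i)) (m<n⇒m%n≡m (toℕ<n j))
    successor i j (inj₂ (i≡m∸1 , j≡0)) =
      trans (cong (λ t → suc t % m) i≡m∸1) (trans (cong (_% m) 1+[m∸1]≡m) (trans (n%n≡0 m) (sym j≡0)))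

  -- By injectivity of the cycle, the added edge uv sits only at positions ≡ k₀ (mod m): reversed,
  -- it would force k₀ + 2 ≡ k₀. So the m - 1 edges following position k₀ all lie in G.
  walk-around : ∀ {u v} → NewEdgesJoin u v → 2 < m →
                ∀ k₀ → h k₀ ≡ u → h (suc k₀) ≡ v → Walk G v u (m ∸ 1)
  walk-around only-uv 2<m k₀ h₀≡u h₁≡v =
    subst₂ (λ a b → Walk G a b (m ∸ 1)) h₁≡v (trans (h-periodic back-to-k₀) h₀≡u)
           (walk-along G h′ (m ∸ 1) edges)
    where
    h′ : ℕ → Fin n
    h′ i = h (suc i + k₀)

    back-to-k₀ : (suc (m ∸ 1) + k₀) % m ≡ k₀ % m
    back-to-k₀ = trans (cong (λ t → (t + k₀) % m) 1+[m∸1]≡m)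
                       (trans (cong (_% m) (+-comm m k₀)) ([m+n]%n≡m%n k₀ m))

    edges : ∀ i → i < m ∸ 1 → Adjacent G (h′ i) (h′ (suc i))
    edges i i<m∸1 with adj G (h′ i) (h′ (suc i)) in ¬edge
    ... | true  = refl
    ... | false with only-uv (h-edge (suc i + k₀)) ¬edge
    ...   | inj₁ (h′i≡u , _) =
      contradiction (h-position (trans h′i≡u (sym h₀≡u)))
                    ([j+a]%m≢a%m (suc i) k₀ z<s (subst (suc i <_) 1+[m∸1]≡m (s≤s i<m∸1)))
    ...   | inj₂ (h′i≡v , h′[1+i]≡u) =
      contradiction (trans (sym (%-cong-suc (h-position (trans h′i≡v (sym h₁≡v)))))
                           (h-position (trans h′[1+i]≡u (sym h₀≡u))))
                    ([j+a]%m≢a%m 2 k₀ z<s 2<m)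

  walk-between : 2 < m → ¬ ContainsCycle (adj G) m → Walk G x y (m ∸ 1) ⊎ Walk G y x (m ∸ 1)
  walk-between 2<m no-cycle
    with k₀ , ¬edge ← ¬∀⟶∃¬ m _ (λ i → adj G (h (toℕ i)) (h (suc (toℕ i))) Bool.≟ true)
                                (no-cycle ∘ cycle-in-G)
    with added-edge (adj G) (h-edge (toℕ k₀)) (¬-not ¬edge)
  ... | inj₁ (h₀≡x , h₁≡y) = inj₂ (walk-around (added-edge (adj G)) 2<m (toℕ k₀) h₀≡x h₁≡y)
  ... | inj₂ (h₀≡y , h₁≡x) = inj₁ (walk-around y-x-only 2<m (toℕ k₀) h₀≡y h₁≡x)
    where
    y-x-only : NewEdgesJoin y x
    y-x-only ab ¬ab = Sum.swap (added-edge (adj G) ab ¬ab)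

saturated⇒dist≤ : ∀ {n m} (G : Graph n) → 2 < m → Saturated G m →
                  ∀ {x y} → x ≢ y → dist≤ G x y (m ∸ 1)
saturated⇒dist≤ {m = m} G 2<m (no-cycle , saturated) {x} {y} x≢y with adj G x y in xy
... | true  = 1 , ≤-trans (s≤s z≤n) (∸-monoˡ-≤ 1 2<m) , step xy here
... | false with f , f-injective , f-cycle ← saturated x y x≢y xy =
  m ∸ 1 , ≤-refl , [ id , walk-reverse G ]′ (walk-between 2<m no-cycle)
  where
  instance
    m≢0 : NonZero m
    m≢0 = >-nonZero (<-trans z<s 2<m)
  open CycleThroughAddedEdge G f f-injective f-cycle

module _ {n : ℕ} (G : Graph n) where

  adj? : ∀ v u → Dec (Adjacent G v u)
  adj? v u = adj G v u Bool.≟ true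

  neighbours : Fin n → List (Fin n)
  neighbours v = filter (adj? v) (allFin n)

  length-neighbours : ∀ v → length (neighbours v) ≡ deg G v
  length-neighbours v = count (allFin n)
    where
    count : ∀ us → length (filter (adj? v) us) ≡ sum (map (λ u → if adj G v u then 1 else 0) us)
    count []       = refl
    count (u ∷ us) with adj G v u
    ... | true  = cong suc (count us)
    ... | false = count us

  ball : Fin n → ℕ → List (Fin n)
  ball x zero    = [ x ]
  ball x (suc k) = concatMap (λ v → v ∷ neighbours v) (ball x k)

  ∈-ball⁻ : ∀ {x w} k → w ∈ ball x k → dist≤ G x w k
  ∈-ball⁻ zero    (here refl) = 0 , z≤n , here
  ∈-ball⁻ (suc k) w∈ball with find (∈-concatMap⁻ (λ v → v ∷ neighbours v) w∈ball)
  ... | v , v∈ball , here refl = dist≤-weaken G (n≤1+n k) (∈-ball⁻ k v∈ball)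
  ... | v , v∈ball , there w∈nv with j , j≤k , p ← ∈-ball⁻ k v∈ball =
    suc j , s≤s j≤k , walk-snoc G p (proj₂ (∈-filter⁻ (adj? v) {xs = allFin n} w∈nv))

  ball-step : ∀ {x v w k} → v ∈ ball x k → Adjacent G v w → w ∈ ball x (suc k)
  ball-step {v = v} v∈ball vw =
    ∈-concatMap⁺ _ (lose v∈ball (there (∈-filter⁺ (adj? v) (∈-allFin _) vw)))

  ball-mono : ∀ {x w k} d → w ∈ ball x k → w ∈ ball x (d + k)
  ball-mono zero    w∈ball = w∈ball
  ball-mono (suc d) w∈ball = ∈-concatMap⁺ _ (lose (ball-mono d w∈ball) (here refl))

  walk-from-ball : ∀ {x v w a j} → v ∈ ball x a → Walk G v w j → w ∈ ball x (j + a)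
  walk-from-ball v∈ball here = v∈ball
  walk-from-ball {x} {w = w} {a} v∈ball (step {k = j} vv′ p) =
    subst (λ t → w ∈ ball x t) (+-suc j a) (walk-from-ball (ball-step {x} {k = a} v∈ball vv′) p)

  ∈-ball⁺ : ∀ {x w k} → dist≤ G x w k → w ∈ ball x k
  ∈-ball⁺ {x} {w} {k} (j , j≤k , p) =
    subst (λ t → w ∈ ball x t) (trans (cong (k ∸ j +_) (+-identityʳ j)) (m∸n+n≡m j≤k))
          (ball-mono (k ∸ j) (walk-from-ball (here refl) p))

  length-ball-suc : ∀ {x c} k → (∀ w → dist≤ G x w k → deg G w ≤ c) →
                    length (ball x (suc k)) ≤ length (ball x k) * suc c
  length-ball-suc k deg≤c = length-concatMap-≤ _
    (All.tabulate λ {v} v∈ball →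
      s≤s (≤-trans (≤-reflexive (length-neighbours v)) (deg≤c v (∈-ball⁻ k v∈ball))))

  length-ball : ∀ {x c} k → (∀ w → dist≤ G x w k → deg G w ≤ c) →
                length (ball x (suc k)) ≤ suc c ^ suc k
  length-ball {c = c} zero    deg≤c =
    ≤-trans (length-ball-suc 0 deg≤c)
            (≤-reflexive (trans (*-identityˡ (suc c)) (sym (*-identityʳ (suc c)))))
  length-ball {c = c} (suc k) deg≤c =
    ≤-trans (length-ball-suc (suc k) deg≤c)
            (≤-trans (*-monoˡ-≤ (suc c) (length-ball k λ w → deg≤c w ∘ dist≤-weaken G (n≤1+n k)))
                     (≤-reflexive (*-comm (suc c ^ suc k) (suc c))))

interleave : {A : Set} → (ℕ → A) → (ℕ → A) → ℕ → A
interleave p q zero          = p 0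
interleave p q (suc zero)    = q 0
interleave p q (suc (suc i)) = interleave (p ∘ suc) (q ∘ suc) i

interleave-even : ∀ {A : Set} (p q : ℕ → A) a → interleave p q (2 * a) ≡ p a
interleave-even p q zero    = refl
interleave-even p q (suc a) =
  trans (cong (interleave p q) (*-suc 2 a)) (interleave-even (p ∘ suc) (q ∘ suc) a)

interleave-odd : ∀ {A : Set} (p q : ℕ → A) a → interleave p q (suc (2 * a)) ≡ q a
interleave-odd p q zero    = refl
interleave-odd p q (suc a) =
  trans (cong (interleave p q ∘ suc) (*-suc 2 a)) (interleave-odd (p ∘ suc) (q ∘ suc) a)

parity : ∀ i → ∃ λ a → i ≡ 2 * a ⊎ i ≡ suc (2 * a)
parity zero = 0 , inj₁ refl
parity (suc i) with parity i
... | a , inj₁ refl = a , inj₂ refl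
... | a , inj₂ refl = suc a , inj₁ (sym (*-suc 2 a))

2k∸1-odd : ∀ {k} → 0 < k → ∃ λ a → a < k × 2 * k ∸ 1 ≡ suc (2 * a)
2k∸1-odd {suc k′} _ = k′ , ≤-refl , cong (_∸ 1) (*-suc 2 k′)

module _ {n k : ℕ} (G : Graph n) (p q : ℕ → Fin n)
         (p-injective : ∀ {a b} → a < k → b < k → p a ≡ p b → a ≡ b)
         (q-injective : ∀ {a b} → a < k → b < k → q a ≡ q b → a ≡ b)
         (p≢q : ∀ {a b} → a < k → b < k → p a ≢ q b)
         (complete : ∀ {a b} → a < k → b < k → Adjacent G (p a) (q b)) where

  private
    half-< : ∀ {a} → 2 * a < 2 * k → a < k
    half-< = *-cancelˡ-< 2 _ _

    data Position : ℕ → Set where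
      left  : ∀ {a} → a < k → Position (2 * a)
      right : ∀ {a} → a < k → Position (suc (2 * a))

    position : ∀ {s} → s < 2 * k → Position s
    position {s} s<2k with parity s
    ... | a , inj₁ refl = left {a} (half-< s<2k)
    ... | a , inj₂ refl = right {a} (half-< (<-trans (n<1+n _) s<2k))

    vertex : ∀ {s} → Position s → Fin n
    vertex (left  {a} _) = p a
    vertex (right {a} _) = q a

    interleave-vertex : ∀ {s} (π : Position s) → interleave p q s ≡ vertex π
    interleave-vertex (left  {a} _) = interleave-even p q a
    interleave-vertex (right {a} _) = interleave-odd p q a

    vertex-injective : ∀ {s t} (π : Position s) (τ : Position t) → vertex π ≡ vertex τ → s ≡ t
    vertex-injective (left  a<k) (left  b<k) pa≡pb = cong (2 *_) (p-injective a<k b<k pa≡pb)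
    vertex-injective (right a<k) (right b<k) qa≡qb = cong (suc ∘ (2 *_)) (q-injective a<k b<k qa≡qb)
    vertex-injective (left  a<k) (right b<k) pa≡qb = contradiction pa≡qb (p≢q a<k b<k)
    vertex-injective (right a<k) (left  b<k) qa≡pb = contradiction (sym qa≡pb) (p≢q b<k a<k)

    consecutive : ∀ s → suc s < 2 * k → Adjacent G (interleave p q s) (interleave p q (suc s))
    consecutive s 1+s<2k with position (<-trans (n<1+n s) 1+s<2k)
    ... | left {a} a<k =
      subst₂ (Adjacent G) (sym (interleave-even p q a)) (sym (interleave-odd p q a)) (complete a<k a<k)
    ... | right {a} a<k =
      subst₂ (Adjacent G) (sym (interleave-odd p q a)) (sym (interleave-even (p ∘ suc) (q ∘ suc) a))
             (adj-sym G (complete (half-< (subst (_< 2 * k) (sym (*-suc 2 a)) 1+s<2k)) a<k))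

    f : Fin (2 * k) → Fin n
    f i = interleave p q (toℕ i)

  complete-bipartite-cycle : ContainsCycle (adj G) (2 * k)
  complete-bipartite-cycle = f , f-injective , f-cycle
    where
    f-injective : ∀ {i j} → f i ≡ f j → i ≡ j
    f-injective {i} {j} fi≡fj =
      toℕ-injective (vertex-injective πi πj
        (trans (sym (interleave-vertex πi)) (trans fi≡fj (interleave-vertex πj))))
      where
      πi = position (toℕ<n i)
      πj = position (toℕ<n j)

    f-cycle : ∀ i j → Next i j → Adjacent G (f i) (f j)
    f-cycle i j (inj₁ j≡1+i) =
      subst (λ t → Adjacent G (f i) (interleave p q t)) (sym j≡1+i)
            (consecutive (toℕ i) (subst (_< 2 * k) j≡1+i (toℕ<n j)))
    f-cycle i j (inj₂ (i≡2k∸1 , j≡0))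
      with a , a<k , 2k∸1≡1+2a ← 2k∸1-odd (half-< (≤-<-trans z≤n (toℕ<n i))) =
      subst₂ (Adjacent G)
             (sym (trans (cong (interleave p q) (trans i≡2k∸1 2k∸1≡1+2a)) (interleave-odd p q a)))
             (cong (interleave p q) (sym j≡0))
             (adj-sym G (complete (≤-<-trans z≤n a<k) a<k))

module _ {n : ℕ} {S : Fin n → Set} {B : Fin n → Fin n → Set} where

  private
    M : Fin n → Set
    M w = ∃ λ x → S x × B x w

    centres : ∀ {ws} → All M ws → List (Fin n)
    centres = All.reduce proj₁

    centres-S : ∀ {ws} (Mws : All M ws) → All S (centres Mws)
    centres-S []                   = []
    centres-S ((_ , Sx , _) ∷ Mws) = Sx ∷ centres-S Mws

    centres-cover : ∀ {ws w} (Mws : All M ws) → w ∈ ws → ∃ λ x → x ∈ centres Mws × B x w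
    centres-cover ((x , _ , Bxw) ∷ _) (here refl)  = x , here refl , Bxw
    centres-cover (_ ∷ Mws)           (there w∈ws) with x , x∈ , Bxw ← centres-cover Mws w∈ws =
      x , there x∈ , Bxw

  AtMost-⋃ : (ball : Fin n → List (Fin n)) {s L : ℕ} → (∀ {x w} → B x w → w ∈ ball x) →
             (∀ {x} → S x → length (ball x) ≤ L) → AtMost S s → AtMost M (s * L)
  AtMost-⋃ ball {s} {L} covered small few ws unique Mws = begin
    length ws                  ≤⟨ Unique-⊆⇒length-≤ unique ws⊆ ⟩
    length (concatMap ball xs) ≤⟨ length-concatMap-≤ ball (All.map small xs-S) ⟩
    length xs * L              ≤⟨ *-monoˡ-≤ L (few xs (deduplicate-! _≟_ _) xs-S) ⟩
    s * L                      ∎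
    where
    open ≤-Reasoning
    xs = deduplicate _≟_ (centres Mws)

    xs-S : All S xs
    xs-S = All.tabulate λ x∈ → All.lookup (centres-S Mws) (∈-deduplicate⁻ _≟_ _ x∈)

    ws⊆ : ws ⊆ concatMap ball xs
    ws⊆ w∈ws with x , x∈ , Bxw ← centres-cover Mws w∈ws =
      ∈-concatMap⁺ ball (lose (∈-deduplicate⁺ _≟_ x∈) (covered Bxw))

module Constants (l : ℕ) where

  ℓ : ℕ
  ℓ = suc (suc l)

  2<2ℓ : 2 < 2 * ℓ
  2<2ℓ = ≤-trans (s≤s (s≤s (s≤s z≤n))) (*-monoʳ-≤ 2 (s≤s (s≤s (z≤n {l}))))

  2ℓ∸1≡1+[ℓ∸1]+[ℓ∸1] : 2 * ℓ ∸ 1 ≡ suc (suc l + suc l)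
  2ℓ∸1≡1+[ℓ∸1]+[ℓ∸1] =
    trans (cong (_∸ 1) (*-suc 2 (suc l))) (cong (λ t → suc (suc l + t)) (+-identityʳ (suc l)))

  ballSize : ℕ
  ballSize = suc (6 * ℓ ∸ 5) ^ suc l

  colours : List (ℕ × ℕ)
  colours = cartesianProduct (upTo ballSize) (upTo ballSize)

  centreBound : ℕ
  centreBound = ramseyBound (length colours) (suc l + ℓ)

module DisjointBalls (l : ℕ) {n : ℕ} (G : Graph n) (sat : Saturated G (2 * suc (suc l)))
                     (S : Fin n → Set) (admissible : ∀ x → S x → Admissible G (suc (suc l)) x)
                     (disjoint : ∀ x y → S x → S y → x ≢ y → DisjointD G (suc (suc l)) x y) where
  open Constants l

  D : Fin n → List (Fin n)
  D x = ball G x (suc l)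

  length-D : ∀ {x} → S x → length (D x) ≤ ballSize
  length-D {x} Sx = length-ball G l λ w d → <⇒≤ (admissible x Sx w d)

  -- Past the end of D x this returns x itself, which still lies in D(x).
  element : Fin n → ℕ → Fin n
  element x = nth x (D x)

  element-∈D : ∀ x k → InD G ℓ x (element x k)
  element-∈D x k with nth-∈ x (D x) k
  ... | inj₁ ∈D = ∈-ball⁻ G (suc l) ∈D
  ... | inj₂ ≡x = subst (InD G ℓ x) (sym ≡x) (0 , z≤n , here)

  edge-between-D : ∀ {x y} → x ≢ y → ∃₂ λ i j →
                   (i < length (D x) × j < length (D y)) × Adjacent G (element x i) (element y j)
  edge-between-D {x} {y} x≢y
    with u , v , xu , uv , vy ←
           dist≤-split G (suc l) (suc l) x≢y
             (dist≤-weaken G (≤-reflexive 2ℓ∸1≡1+[ℓ∸1]+[ℓ∸1]) (saturated⇒dist≤ G 2<2ℓ sat x≢y))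
    with i , i< , xᵢ≡u ← ∈⇒nth x (∈-ball⁺ G xu)
    with j , j< , yⱼ≡v ← ∈⇒nth y (∈-ball⁺ G (dist≤-sym G vy))
    = i , j , (i< , j<) , subst₂ (Adjacent G) (sym xᵢ≡u) (sym yⱼ≡v) uv

  -- The value (0 , 0) on the diagonal is junk: only pairs of distinct vertices are coloured.
  colour : Fin n → Fin n → ℕ × ℕ
  colour x y with x ≟ y
  ... | yes _   = 0 , 0
  ... | no  x≢y = proj₁ (edge-between-D x≢y) , proj₁ (proj₂ (edge-between-D x≢y))

  colour-spec : ∀ {x y} → x ≢ y → let (i , j) = colour x y in
                (i < length (D x) × j < length (D y)) × Adjacent G (element x i) (element y j)
  colour-spec {x} {y} x≢y with x ≟ y
  ... | yes x≡y  = contradiction x≡y x≢y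
  ... | no  x≢y′ = proj₂ (proj₂ (edge-between-D x≢y′))

  DistinctCentres : Fin n → Fin n → Set
  DistinctCentres x y = S x × S y × x ≢ y

  colour∈colours : ∀ {x y} → DistinctCentres x y → colour x y ∈ colours
  colour∈colours (Sx , Sy , x≢y) with (i< , j<) , _ ← colour-spec x≢y =
    ∈-cartesianProduct⁺ (∈-upTo⁺ (<-≤-trans i< (length-D Sx))) (∈-upTo⁺ (<-≤-trans j< (length-D Sy)))

  elements-distinct : ∀ {x y} → DistinctCentres x y → ∀ i j → element x i ≢ element y j
  elements-distinct (Sx , Sy , x≢y) i j xᵢ≡yⱼ =
    disjoint _ _ Sx Sy x≢y _ (element-∈D _ i , subst (InD G ℓ _) (sym xᵢ≡yⱼ) (element-∈D _ j))

  module _ {c : ℕ × ℕ} (y₀ : Fin n) {ys : List (Fin n)}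
           (mono : AllPairs (λ a b → DistinctCentres a b × colour a b ≡ c) ys)
           (long : ℓ + ℓ ≤ length ys) where

    private
      z : ℕ → Fin n
      z = nth y₀ ys

      pair : ∀ {s t} → s < t → t < ℓ + ℓ → DistinctCentres (z s) (z t) × colour (z s) (z t) ≡ c
      pair s<t t< = nth-AllPairs y₀ mono s<t (<-≤-trans t< long)

      z-injective : ∀ {s t i j} → s < ℓ + ℓ → t < ℓ + ℓ → element (z s) i ≡ element (z t) j → s ≡ t
      z-injective {s} {t} s< t< zₛᵢ≡zₜⱼ with <-cmp s t
      ... | tri< s<t _ _ = contradiction zₛᵢ≡zₜⱼ (elements-distinct (proj₁ (pair s<t t<)) _ _)
      ... | tri≈ _ s≡t _ = s≡t
      ... | tri> _ _ t<s = contradiction (sym zₛᵢ≡zₜⱼ) (elements-distinct (proj₁ (pair t<s s<)) _ _)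

      <ℓ⇒<ℓ+ℓ : ∀ {a} → a < ℓ → a < ℓ + ℓ
      <ℓ⇒<ℓ+ℓ a<ℓ = <-≤-trans a<ℓ (m≤m+n ℓ ℓ)

      p q : ℕ → Fin n
      p a = element (z a) (proj₁ c)
      q b = element (z (ℓ + b)) (proj₂ c)

      complete : ∀ {a b} → a < ℓ → b < ℓ → Adjacent G (p a) (q b)
      complete {a} {b} a<ℓ b<ℓ
        with (_ , _ , za≢zb) , colour≡c ← pair (≤-trans a<ℓ (m≤m+n ℓ b)) (+-monoʳ-< ℓ b<ℓ) =
        subst (λ (i , j) → Adjacent G (element (z a) i) (element (z (ℓ + b)) j)) colour≡c
              (proj₂ (colour-spec za≢zb))

    monochromatic-cycle : ContainsCycle (adj G) (2 * ℓ)
    monochromatic-cycle = complete-bipartite-cycle G p q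
      (λ a< b< → z-injective (<ℓ⇒<ℓ+ℓ a<) (<ℓ⇒<ℓ+ℓ b<))
      (λ a< b< → +-cancelˡ-≡ ℓ _ _ ∘ z-injective (+-monoʳ-< ℓ a<) (+-monoʳ-< ℓ b<))
      (λ {a} {b} a< b< → <⇒≢ (<-≤-trans a< (m≤m+n ℓ b)) ∘ z-injective (<ℓ⇒<ℓ+ℓ a<) (+-monoʳ-< ℓ b<))
      complete

  open Ramsey (≡-dec ℕ._≟_ ℕ._≟_) colour colours colour∈colours using (ramsey)

  few-centres : AtMost S centreBound
  few-centres zs unique Szs with centreBound ≤? length zs
  ... | no  ≰ = <⇒≤ (≰⇒> ≰)
  ... | yes ≤ with ramsey (suc l + ℓ) (AllPairs-withAll Szs unique) ≤
  ...   | c , y₀ ∷ ys , mono , long = ⊥-elim (proj₁ sat (monochromatic-cycle y₀ mono long))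

  ⋃D-bounded : AtMost (λ w → ∃ λ x → S x × InD G ℓ x w) (centreBound * ballSize)
  ⋃D-bounded = AtMost-⋃ D (∈-ball⁺ G) length-D few-centres

lemma4p5 : (ℓ : ℕ) → 14 ≤ ℓ → ∃ λ (K : ℕ) →
    ∀ (n : ℕ) (G : Graph n) → Saturated G (2 * ℓ) →
    ∀ (𝒫 : List (Fin (2 * ℓ ∸ 3) → Fin n)) →
      All (Deg2Path G (2 * ℓ ∸ 3)) 𝒫 →
      AllPairs VDisjoint 𝒫 →
      (∀ q → Deg2Path G (2 * ℓ ∸ 3) q → ¬ All (VDisjoint q) 𝒫) →
    ∀ (S : Fin n → Set) →
      All (λ p → ∀ i → toℕ i ≡ ℓ ∸ 2 → S (p i)) 𝒫 →
      (∀ x → S x → Admissible G ℓ x) →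
      (∀ x y → S x → S y → x ≢ y → DisjointD G ℓ x y) →
      (∀ v → Admissible G ℓ v → ¬ S v → ¬ (∀ x → S x → DisjointD G ℓ v x)) →
    AtMost (λ w → ∃ λ x → S x × InD G ℓ x w) K
lemma4p5 zero          ()
lemma4p5 (suc zero)    (s≤s ())
lemma4p5 (suc (suc l)) _ = centreBound * ballSize , λ n G sat _ _ _ _ S _ admissible disjoint _ →
  DisjointBalls.⋃D-bounded l G sat S admissible disjoint
  where open Constants l
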